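{- Every dark ceer is self-full.
   Context: A ceer is a computably enumerable equivalence relation on $\omega$. For equivalence relations $E,R$ on $\omega$, $E\leq R$ (via $f$) means $f$ is computable and $x\mathrel{E}y\iff f(x)\mathrel{R}f(y)$ for all $x,y$. $\mathrm{Id}$ is equality on $\omega$. A ceer $R$ is dark if it has infinitely many classes and $\mathrm{Id}\not\leq R$. A ceer $E$ is self-full if for every computable $g$ that is a reduction of $E$ to $E$ and every $j\in\omega$ there is $k$ with $g(k)\mathrel{E}j$. -}

module Defs where

open import Data.Nat using (ℕ; zero; suc; _<_)
open import Data.Fin using (Fin)
open import Data.Vec using (Vec; []; _∷_; lookup; map)
open import Data.List using (List)
open import Data.List.Relation.Unary.Any using (Any)
open import Data.Product using (Σ; ∃; _×_)
open import Relation.Nullary using (¬_)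
open import Relation.Binary.PropositionalEquality using (_≡_)
open import Relation.Binary.Structures using (IsEquivalence)

data Code : ℕ → Set where
  zer  : ∀ {n} → Code n
  succ : Code 1
  proj : ∀ {n} → Fin n → Code n
  comp : ∀ {n m} → Code m → Vec (Code n) m → Code n
  prec : ∀ {n} → Code n → Code (suc (suc n)) → Code (suc n)
  mu   : ∀ {n} → Code (suc n) → Code n

-- Big-step evaluation: c ⊢ xs ⇓ v means the partial function coded by c
-- converges on input xs with output v.
data _⊢_⇓_ : ∀ {n} → Code n → Vec ℕ n → ℕ → Set
data _⊢*_⇓_ : ∀ {n m} → Vec (Code n) m → Vec ℕ n → Vec ℕ m → Set

data _⊢_⇓_ where
  ev-zer  : ∀ {n} {xs : Vec ℕ n} → zer ⊢ xs ⇓ 0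
  ev-succ : ∀ {x} → succ ⊢ (x ∷ []) ⇓ suc x
  ev-proj : ∀ {n} {i : Fin n} {xs} → proj i ⊢ xs ⇓ lookup xs i
  ev-comp : ∀ {n m} {f : Code m} {gs : Vec (Code n) m} {xs ys v} →
            gs ⊢* xs ⇓ ys → f ⊢ ys ⇓ v → comp f gs ⊢ xs ⇓ v
  ev-prec-z : ∀ {n} {f : Code n} {g} {xs v} →
              f ⊢ xs ⇓ v → prec f g ⊢ (0 ∷ xs) ⇓ v
  ev-prec-s : ∀ {n} {f : Code n} {g} {k xs r v} →
              prec f g ⊢ (k ∷ xs) ⇓ r → g ⊢ (k ∷ r ∷ xs) ⇓ v →
              prec f g ⊢ (suc k ∷ xs) ⇓ v
  ev-mu   : ∀ {n} {f : Code (suc n)} {xs k} →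
            f ⊢ (k ∷ xs) ⇓ 0 →
            (∀ i → i < k → Σ ℕ (λ r → f ⊢ (i ∷ xs) ⇓ suc r)) →
            mu f ⊢ xs ⇓ k

data _⊢*_⇓_ where
  ev-[] : ∀ {n} {xs : Vec ℕ n} → [] ⊢* xs ⇓ []
  ev-∷  : ∀ {n m} {g : Code n} {gs : Vec (Code n) m} {xs y ys} →
          g ⊢ xs ⇓ y → gs ⊢* xs ⇓ ys → (g ∷ gs) ⊢* xs ⇓ (y ∷ ys)

Computable : (ℕ → ℕ) → Set
Computable f = Σ (Code 1) λ c → ∀ x → c ⊢ (x ∷ []) ⇓ f x

Rel₀ : Set₁
Rel₀ = ℕ → ℕ → Set

-- A relation is c.e. if it is the domain of a partial computable function.
CE : Rel₀ → Set
CE E = Σ (Code 2) λ c → ∀ x y →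
         (E x y → ∃ λ v → c ⊢ (x ∷ y ∷ []) ⇓ v) ×
         ((∃ λ v → c ⊢ (x ∷ y ∷ []) ⇓ v) → E x y)

IsCeer : Rel₀ → Set
IsCeer E = IsEquivalence E × CE E

ReducesVia : Rel₀ → Rel₀ → (ℕ → ℕ) → Set
ReducesVia E R f = Computable f ×
  (∀ x y → (E x y → R (f x) (f y)) × (R (f x) (f y) → E x y))

_≤ᶜ_ : Rel₀ → Rel₀ → Set
E ≤ᶜ R = Σ (ℕ → ℕ) λ f → ReducesVia E R f

Id : Rel₀
Id = _≡_

FinitelyManyClasses : Rel₀ → Set
FinitelyManyClasses E = Σ (List ℕ) λ l → ∀ x → Any (E x) l

InfinitelyManyClasses : Rel₀ → Set
InfinitelyManyClasses E = ¬ FinitelyManyClasses E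

Dark : Rel₀ → Set
Dark R = InfinitelyManyClasses R × ¬ (Id ≤ᶜ R)

SelfFull : Rel₀ → Set
SelfFull E = ∀ g → ReducesVia E E g → ∀ j → ∃ λ k → E (g k) j

-- If some j were outside the E-range of a self-reduction g, then since g
-- reflects E, the orbit j, g j, g (g j), … would meet every E-class at most
-- once, so n ↦ gⁿ j would be a computable reduction of Id to E, which a dark
-- ceer does not admit.
module Submission where

open import Defs
open import Level using (0ℓ)
open import Axiom.ExcludedMiddle using (ExcludedMiddle)
open import Data.Nat using (ℕ; zero; suc)
open import Data.Nat.GeneralisedArithmetic using (fold)
open import Data.Fin using () renaming (zero to fzero; suc to fsuc)
open import Data.Vec using ([]; _∷_)
open import Data.Product using (∃; _,_; proj₂)
open import Data.Empty using (⊥-elim)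
open import Relation.Nullary using (¬_; yes; no)
open import Relation.Binary.PropositionalEquality using (_≡_; refl; cong)
open import Relation.Binary.Structures using (IsEquivalence)

numeral : ℕ → Code 0
numeral zero    = zer
numeral (suc n) = comp succ (numeral n ∷ [])

numeral-⇓ : ∀ n → numeral n ⊢ [] ⇓ n
numeral-⇓ zero    = ev-zer
numeral-⇓ (suc n) = ev-comp (ev-∷ (numeral-⇓ n) ev-[]) ev-succ

fold-computable : ∀ {g} → Computable g → ∀ j → Computable (fold j g)
fold-computable {g} (c , c⇓) j =
  prec (numeral j) (comp c (proj (fsuc fzero) ∷ [])) , fold-⇓
  where
  fold-⇓ : ∀ n → _ ⊢ (n ∷ []) ⇓ fold j g n
  fold-⇓ zero    = ev-prec-z (numeral-⇓ j)
  fold-⇓ (suc n) = ev-prec-s (fold-⇓ n) (ev-comp (ev-∷ ev-proj ev-[]) (c⇓ _))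

module _ {E : Rel₀} (isEquivalence : IsEquivalence E) {g : ℕ → ℕ}
         (g-reflects : ∀ a b → E (g a) (g b) → E a b)
         {j : ℕ} (j∉range : ¬ (∃ λ k → E (g k) j)) where

  open IsEquivalence isEquivalence using (sym; reflexive)

  orbit-injective : ∀ m n → E (fold j g m) (fold j g n) → m ≡ n
  orbit-injective zero    zero    _ = refl
  orbit-injective zero    (suc n) e = ⊥-elim (j∉range (fold j g n , sym e))
  orbit-injective (suc m) zero    e = ⊥-elim (j∉range (fold j g m , e))
  orbit-injective (suc m) (suc n) e = cong suc (orbit-injective m n (g-reflects _ _ e))

  orbit-reduces-Id : Computable g → ReducesVia Id E (fold j g)
  orbit-reduces-Id g-computable =
    fold-computable g-computable j ,
    λ m n → (λ m≡n → reflexive (cong (fold j g) m≡n)) , orbit-injective m n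

lemma4p6 : ExcludedMiddle 0ℓ → (E : Rel₀) → IsCeer E → Dark E → SelfFull E
lemma4p6 em E (isEquivalence , _) (_ , Id≰E) g (g-computable , g-reduces) j
  with em {∃ λ k → E (g k) j}
... | yes j∈range = j∈range
... | no  j∉range =
  ⊥-elim (Id≰E (fold j g , orbit-reduces-Id isEquivalence g-reflects j∉range g-computable))
  where
  g-reflects : ∀ a b → E (g a) (g b) → E a b
  g-reflects a b = proj₂ (g-reduces a b)
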